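{- Let $G$ be a connected graph with at least $2$ vertices and $H$ a connected graph. Then \[F(G+_Q H)=|V(H)|F(G)+|V(G)|F(H)+6|E(H)|M_1(G)+6|E(G)|M_1(H)+|V(H)|\xi_4(G)+3|V(H)|\,\mathrm{ReZM}(G).\]
   Context: All graphs are finite, simple and undirected; $d_G(v)$ denotes degree. $F(G)=\sum_{v\in V(G)}d_G(v)^3$, $M_1(G)=\sum_{v\in V(G)}d_G(v)^2$, $\xi_4(G)=\sum_{v\in V(G)}d_G(v)^4$, and $\mathrm{ReZM}(G)=\sum_{uv\in E(G)}d_G(u)d_G(v)[d_G(u)+d_G(v)]$. The line superposition graph $Q(G)$ has vertex set $V(G)\cup E(G)$ and is obtained from $G$ by inserting a new vertex into each edge of $G$ (so each edge $e=uv$ becomes the path $u\,e\,v$) and then joining by edges each pair of new vertices lying on adjacent edges of $G$. The $Q$-sum $G+_Q H$ is the graph with vertex set $(V(G)\cup E(G))\times V(H)$ in which $(u,v)$ and $(u',v')$ are adjacent if and only if [$u=u'\in V(G)$ and $vv'\in E(H)$] or [$v=v'$ and $uu'\in E(Q(G))$]. -}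

module Defs where

open import Data.Nat using (ℕ; zero; suc; _+_; _*_; _^_; _≡ᵇ_; _<ᵇ_)
open import Data.Fin using (Fin; toℕ)
open import Data.Bool using (Bool; true; false; _∧_; _∨_; not)
open import Data.List using (List; []; _∷_; map; _++_; length; filterᵇ; cartesianProduct; allFin)
open import Data.Nat.ListAction using (sum)
open import Data.Sum using (_⊎_; inj₁; inj₂)
open import Data.Product using (_×_; _,_)
open import Relation.Binary.PropositionalEquality using (_≡_)

record Graph : Set where
  field
    n      : ℕ
    adj    : Fin n → Fin n → Bool
    sym    : ∀ i j → adj i j ≡ adj j i
    irrefl : ∀ i → adj i i ≡ false
open Graph public

-- A finite graph presented by a duplicate-free list of all its vertices and a
-- Bool-valued adjacency relation (used for constructed graphs such as Q-sums).
record FinGraph : Set₁ where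
  field
    Vtx   : Set
    verts : List Vtx
    adjF  : Vtx → Vtx → Bool
open FinGraph public

degF : (X : FinGraph) → Vtx X → ℕ
degF X v = length (filterᵇ (adjF X v) (verts X))

FF : FinGraph → ℕ
FF X = sum (map (λ v → degF X v ^ 3) (verts X))

toFinGraph : Graph → FinGraph
toFinGraph G = record { Vtx = Fin (n G) ; verts = allFin (n G) ; adjF = adj G }

∣V∣ : Graph → ℕ
∣V∣ G = n G

deg : (G : Graph) → Fin (n G) → ℕ
deg G = degF (toFinGraph G)

_==_ : ∀ {k} → Fin k → Fin k → Bool
a == b = toℕ a ≡ᵇ toℕ b

edges : (G : Graph) → List (Fin (n G) × Fin (n G))
edges G = filterᵇ (λ { (i , j) → (toℕ i <ᵇ toℕ j) ∧ adj G i j })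
                  (cartesianProduct (allFin (n G)) (allFin (n G)))

∣E∣ : Graph → ℕ
∣E∣ G = length (edges G)

F : Graph → ℕ
F G = FF (toFinGraph G)

M₁ : Graph → ℕ
M₁ G = sum (map (λ v → deg G v ^ 2) (allFin (n G)))

ξ₄ : Graph → ℕ
ξ₄ G = sum (map (λ v → deg G v ^ 4) (allFin (n G)))

ReZM : Graph → ℕ
ReZM G = sum (map (λ { (u , v) → deg G u * deg G v * (deg G u + deg G v) }) (edges G))

-- Vertices of Q(G): V(G) ∪ E(G)
QVtx : Graph → Set
QVtx G = Fin (n G) ⊎ (Fin (n G) × Fin (n G))

Qverts : (G : Graph) → List (QVtx G)
Qverts G = map inj₁ (allFin (n G)) ++ map inj₂ (edges G)

incident : ∀ {k} → Fin k → Fin k × Fin k → Bool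
incident u (a , b) = (u == a) ∨ (u == b)

Qadj : (G : Graph) → QVtx G → QVtx G → Bool
Qadj G (inj₁ u) (inj₁ u') = false
Qadj G (inj₁ u) (inj₂ e) = incident u e
Qadj G (inj₂ e) (inj₁ u) = incident u e
Qadj G (inj₂ (a , b)) (inj₂ (c , d)) =
  not ((a == c) ∧ (b == d)) ∧ (incident a (c , d) ∨ incident b (c , d))

sameVertex : (G : Graph) → QVtx G → QVtx G → Bool
sameVertex G (inj₁ u) (inj₁ u') = u == u'
sameVertex G _ _ = false

_+Q_ : Graph → Graph → FinGraph
G +Q H = record
  { Vtx   = QVtx G × Fin (n H)
  ; verts = cartesianProduct (Qverts G) (allFin (n H))
  ; adjF  = λ { (x , v) (x' , v') →
                  (sameVertex G x x' ∧ adj H v v') ∨ ((v == v') ∧ Qadj G x x') }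
  }

data Walk (G : Graph) : Fin (n G) → Fin (n G) → Set where
  here : ∀ {u} → Walk G u u
  step : ∀ {u v w} → adj G u v ≡ true → Walk G v w → Walk G u w

Connected : Graph → Set
Connected G = ∀ u v → Walk G u v

-- In G +_Q H the copy (u , v) of a vertex u of G has degree d_G(u) + d_H(v), and the copy (e , v)
-- of an edge e = ab has degree d_G(a) + d_G(b): its two ends in Q(G) plus the d_G(a) + d_G(b) − 2
-- edges of G adjacent to e. Expanding the cubes, the mixed vertex terms factor into products of
-- sums evaluated by the handshake lemma ∑ d = 2|E|, and over the edges
-- ∑ (d_a + d_b)³ = ∑ (d_a³ + d_b³) + 3 ∑ d_a d_b (d_a + d_b) = ξ₄(G) + 3 ReZM(G).
module Submission where

open import Defs hiding (sym)
open import Algebra.Properties.CommutativeSemigroup using (interchange)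
open import Data.Bool using (Bool; true; false; _∧_; _∨_; not; if_then_else_; T)
open import Data.Bool.Properties using (∧-zeroʳ; ∨-identityʳ; T-∧; T-≡)
open import Data.Empty using (⊥-elim)
open import Data.Fin using (Fin; toℕ; zero; suc)
open import Data.Fin.Properties using (toℕ-injective)
open import Data.List using (List; []; _∷_; map; _++_; length; filterᵇ; cartesianProduct; allFin)
open import Data.List.Properties using (map-++; map-∘; map-tabulate; length-tabulate)
open import Data.Nat using (ℕ; zero; suc; _+_; _*_; _^_; _<_; _≤_; _<ᵇ_)
open import Data.Nat.ListAction using (sum)
open import Data.Nat.ListAction.Properties using (sum-++)
open import Data.Nat.Properties
  using (+-identityʳ; +-comm; +-commutativeSemigroup; *-comm; *-zeroʳ; *-identityˡ; *-distribˡ-+; *-distribʳ-+;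
         *-cancelˡ-≡; <-asym; <-irrefl; ≮⇒≥; ≤-antisym; ≡ᵇ⇒≡; <ᵇ-reflects-<; <ᵇ⇒<; <⇒<ᵇ)
open import Data.Nat.Tactic.RingSolver using (solve-∀)
open import Data.Product using (_×_; _,_; proj₁; proj₂)
open import Data.Sum using (inj₁; inj₂)
open import Function using (_∘_; id; Equivalence)
open import Relation.Nullary using (¬_)
open import Relation.Nullary.Reflects using (ofʸ; ofⁿ)
open import Relation.Binary.PropositionalEquality
  using (_≡_; _≢_; refl; sym; trans; cong; cong₂; subst₂; module ≡-Reasoning)

private variable
  A B : Set

∑ : List A → (A → ℕ) → ℕ
∑ xs f = sum (map f xs)

∑-syntax : List A → (A → ℕ) → ℕ
∑-syntax = ∑

-- Looser than _+_ and _*_, tighter than _≡_: ∑[ x ← xs ] f x + g x sums f x + g x.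
infix 5 ∑-syntax
syntax ∑-syntax xs (λ x → e) = ∑[ x ← xs ] e

𝟙 : Bool → ℕ
𝟙 true  = 1
𝟙 false = 0

∑-cong : (xs : List A) {f g : A → ℕ} → (∀ x → f x ≡ g x) → ∑ xs f ≡ ∑ xs g
∑-cong []       f≗g = refl
∑-cong (x ∷ xs) f≗g = cong₂ _+_ (f≗g x) (∑-cong xs f≗g)

∑-++ : (xs ys : List A) (f : A → ℕ) → ∑ (xs ++ ys) f ≡ ∑ xs f + ∑ ys f
∑-++ xs ys f = trans (cong sum (map-++ f xs ys)) (sum-++ (map f xs) (map f ys))

∑-map : (g : B → A) (xs : List B) (f : A → ℕ) → ∑ (map g xs) f ≡ ∑ xs (f ∘ g)
∑-map g xs f = cong sum (sym (map-∘ xs))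

∑-distrib-+ : (xs : List A) (f g : A → ℕ) → ∑[ x ← xs ] f x + g x ≡ ∑ xs f + ∑ xs g
∑-distrib-+ []       f g = refl
∑-distrib-+ (x ∷ xs) f g = trans (cong (f x + g x +_) (∑-distrib-+ xs f g))
  (interchange +-commutativeSemigroup (f x) (g x) (∑ xs f) (∑ xs g))

∑-distribˡ-* : (xs : List A) (c : ℕ) (f : A → ℕ) → ∑[ x ← xs ] c * f x ≡ c * ∑ xs f
∑-distribˡ-* []       c f = sym (*-zeroʳ c)
∑-distribˡ-* (x ∷ xs) c f =
  trans (cong (c * f x +_) (∑-distribˡ-* xs c f)) (sym (*-distribˡ-+ c (f x) (∑ xs f)))

∑-zero : (xs : List A) → ∑[ x ← xs ] 0 ≡ 0
∑-zero []       = refl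
∑-zero (x ∷ xs) = ∑-zero xs

∑-const : (xs : List A) (c : ℕ) → ∑[ x ← xs ] c ≡ length xs * c
∑-const []       c = refl
∑-const (x ∷ xs) c = cong (c +_) (∑-const xs c)

∑-if : (xs : List A) (b : Bool) (f : A → ℕ) →
  ∑[ x ← xs ] (if b then f x else 0) ≡ (if b then ∑ xs f else 0)
∑-if xs true  f = refl
∑-if xs false f = ∑-zero xs

∑-comm : (xs : List A) (ys : List B) (f : A → B → ℕ) →
  ∑[ x ← xs ] ∑[ y ← ys ] f x y ≡ ∑[ y ← ys ] ∑[ x ← xs ] f x y
∑-comm []       ys f = sym (∑-zero ys)
∑-comm (x ∷ xs) ys f =
  trans (cong (∑ ys (f x) +_) (∑-comm xs ys f)) (sym (∑-distrib-+ ys (f x) _))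

∑-∑-distrib-+ : (xs : List A) (ys : List B) (f g : A → B → ℕ) →
  ∑[ x ← xs ] ∑[ y ← ys ] f x y + g x y ≡
  (∑[ x ← xs ] ∑[ y ← ys ] f x y) + (∑[ x ← xs ] ∑[ y ← ys ] g x y)
∑-∑-distrib-+ xs ys f g = trans (∑-cong xs (λ x → ∑-distrib-+ ys (f x) (g x))) (∑-distrib-+ xs _ _)

∑-∑-* : (xs : List A) (ys : List B) (f : A → ℕ) (g : B → ℕ) →
  ∑[ x ← xs ] ∑[ y ← ys ] f x * g y ≡ ∑ xs f * ∑ ys g
∑-∑-* []       ys f g = refl
∑-∑-* (x ∷ xs) ys f g = trans (cong₂ _+_ (∑-distribˡ-* ys (f x) g) (∑-∑-* xs ys f g))
  (sym (*-distribʳ-+ (∑ ys g) (f x) (∑ xs f)))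

∑-cartesianProduct : (xs : List A) (ys : List B) (f : A × B → ℕ) →
  ∑ (cartesianProduct xs ys) f ≡ ∑[ x ← xs ] ∑[ y ← ys ] f (x , y)
∑-cartesianProduct []       ys f = refl
∑-cartesianProduct (x ∷ xs) ys f = trans (∑-++ (map (x ,_) ys) _ f)
  (cong₂ _+_ (∑-map (x ,_) ys f) (∑-cartesianProduct xs ys f))

∑-filterᵇ : (p : A → Bool) (xs : List A) (f : A → ℕ) →
  ∑ (filterᵇ p xs) f ≡ ∑[ x ← xs ] (if p x then f x else 0)
∑-filterᵇ p []       f = refl
∑-filterᵇ p (x ∷ xs) f with p x
... | true  = cong (f x +_) (∑-filterᵇ p xs f)
... | false = ∑-filterᵇ p xs f

∑-filterᵇ-cong : (p : A → Bool) (xs : List A) {f g : A → ℕ} →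
  (∀ x → T (p x) → f x ≡ g x) → ∑ (filterᵇ p xs) f ≡ ∑ (filterᵇ p xs) g
∑-filterᵇ-cong p []       f≗g = refl
∑-filterᵇ-cong p (x ∷ xs) f≗g with p x in px
... | true  = cong₂ _+_ (f≗g x (Equivalence.from T-≡ px)) (∑-filterᵇ-cong p xs f≗g)
... | false = ∑-filterᵇ-cong p xs f≗g

length-filterᵇ : (p : A → Bool) (xs : List A) → length (filterᵇ p xs) ≡ ∑ xs (𝟙 ∘ p)
length-filterᵇ p []       = refl
length-filterᵇ p (x ∷ xs) with p x
... | true  = cong suc (length-filterᵇ p xs)
... | false = length-filterᵇ p xs

𝟙-∧ : ∀ b c → 𝟙 (b ∧ c) ≡ (if b then 𝟙 c else 0)
𝟙-∧ true  c = refl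
𝟙-∧ false c = refl

𝟙-* : ∀ b c → 𝟙 b * c ≡ (if b then c else 0)
𝟙-* true  c = +-identityʳ c
𝟙-* false c = refl

if-+ : ∀ b x y → (if b then x + y else 0) ≡ (if b then x else 0) + (if b then y else 0)
if-+ true  x y = refl
if-+ false x y = refl

𝟙-∨-disjoint : ∀ b c → ¬ (T b × T c) → 𝟙 (b ∨ c) ≡ 𝟙 b + 𝟙 c
𝟙-∨-disjoint true  true  ¬b∧c = ⊥-elim (¬b∧c _)
𝟙-∨-disjoint true  false ¬b∧c = refl
𝟙-∨-disjoint false c     ¬b∧c = refl

∑-∑-cube : (xs : List A) (ys : List B) (f : A → ℕ) (g : B → ℕ) →
  ∑[ x ← xs ] ∑[ y ← ys ] (f x + g y) ^ 3 ≡
    length ys * (∑[ x ← xs ] f x ^ 3) + length xs * (∑[ y ← ys ] g y ^ 3)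
    + 3 * (∑ xs f * (∑[ y ← ys ] g y ^ 2)) + 3 * ((∑[ x ← xs ] f x ^ 2) * ∑ ys g)
∑-∑-cube xs ys f g = begin
  ∑[ x ← xs ] ∑[ y ← ys ] (f x + g y) ^ 3
    ≡⟨ ∑-cong xs (λ x → ∑-cong ys (λ y → cube (f x) (g y))) ⟩
  ∑∑ (λ x y → t₁ x y + t₂ x y + t₃ x y + t₄ x y)
    ≡⟨ ∑-∑-distrib-+ xs ys _ t₄ ⟩
  ∑∑ (λ x y → t₁ x y + t₂ x y + t₃ x y) + ∑∑ t₄
    ≡⟨ cong (_+ ∑∑ t₄) (∑-∑-distrib-+ xs ys _ t₃) ⟩
  ∑∑ (λ x y → t₁ x y + t₂ x y) + ∑∑ t₃ + ∑∑ t₄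
    ≡⟨ cong (λ s → s + ∑∑ t₃ + ∑∑ t₄) (∑-∑-distrib-+ xs ys t₁ t₂) ⟩
  ∑∑ t₁ + ∑∑ t₂ + ∑∑ t₃ + ∑∑ t₄
    ≡⟨ cong₂ _+_ (cong₂ _+_ (cong₂ _+_ (∑-∑-* xs ys _ _) (∑-∑-* xs ys _ _)) (∑-∑-* xs ys _ _))
                 (∑-∑-* xs ys _ _) ⟩
  F₃ * (∑[ y ← ys ] 1) + (∑[ x ← xs ] 1) * G₃
    + (∑[ x ← xs ] 3 * f x) * G₂ + (∑[ x ← xs ] 3 * f x ^ 2) * G₁
    ≡⟨ cong₂ _+_ (cong₂ _+_ (cong₂ _+_ (cong (F₃ *_) (∑-const ys 1)) (cong (_* G₃) (∑-const xs 1)))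
                            (cong (_* G₂) (∑-distribˡ-* xs 3 f)))
                 (cong (_* G₁) (∑-distribˡ-* xs 3 (λ x → f x ^ 2))) ⟩
  F₃ * (length ys * 1) + length xs * 1 * G₃ + 3 * F₁ * G₂ + 3 * F₂ * G₁
    ≡⟨ rearrange F₃ G₃ F₁ G₂ F₂ G₁ (length ys) (length xs) ⟩
  length ys * F₃ + length xs * G₃ + 3 * (F₁ * G₂) + 3 * (F₂ * G₁) ∎
  where
  open ≡-Reasoning
  ∑∑ : (_ → _ → ℕ) → ℕ
  ∑∑ t = ∑[ x ← xs ] ∑[ y ← ys ] t x y
  F₁ F₂ F₃ G₁ G₂ G₃ : ℕ
  F₁ = ∑ xs f
  F₂ = ∑[ x ← xs ] f x ^ 2
  F₃ = ∑[ x ← xs ] f x ^ 3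
  G₁ = ∑ ys g
  G₂ = ∑[ y ← ys ] g y ^ 2
  G₃ = ∑[ y ← ys ] g y ^ 3
  t₁ t₂ t₃ t₄ : _ → _ → ℕ
  t₁ x y = f x ^ 3 * 1
  t₂ x y = 1 * g y ^ 3
  t₃ x y = 3 * f x * g y ^ 2
  t₄ x y = 3 * f x ^ 2 * g y
  -- The ring solver does not understand _^_, so it proves the identity with the powers unfolded.
  cube : ∀ a b → (a + b) ^ 3 ≡ a ^ 3 * 1 + 1 * b ^ 3 + 3 * a * b ^ 2 + 3 * a ^ 2 * b
  cube = expanded
    where
    expanded : ∀ a b → (a + b) * ((a + b) * ((a + b) * 1)) ≡
      a * (a * (a * 1)) * 1 + 1 * (b * (b * (b * 1))) + 3 * a * (b * (b * 1)) + 3 * (a * (a * 1)) * b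
    expanded = solve-∀
  rearrange : ∀ F₃ G₃ F₁ G₂ F₂ G₁ m n →
    F₃ * (m * 1) + n * 1 * G₃ + 3 * F₁ * G₂ + 3 * F₂ * G₁ ≡
    m * F₃ + n * G₃ + 3 * (F₁ * G₂) + 3 * (F₂ * G₁)
  rearrange = solve-∀

==⇒≡ : ∀ {k} (i j : Fin k) → T (i == j) → i ≡ j
==⇒≡ i j = toℕ-injective ∘ ≡ᵇ⇒≡ (toℕ i) (toℕ j)

==-sym : ∀ {k} (i j : Fin k) → (i == j) ≡ (j == i)
==-sym zero    zero    = refl
==-sym zero    (suc j) = refl
==-sym (suc i) zero    = refl
==-sym (suc i) (suc j) = ==-sym i j

∑-allFin-suc : ∀ k (f : Fin (suc k) → ℕ) → ∑ (allFin (suc k)) f ≡ f zero + ∑ (allFin k) (f ∘ suc)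
∑-allFin-suc k f =
  cong (λ fs → f zero + sum fs) (trans (map-tabulate suc f) (sym (map-tabulate id (f ∘ suc))))

length-allFin : ∀ k → length (allFin k) ≡ k
length-allFin k = length-tabulate {n = k} id

∑-allFin-const : ∀ k c → ∑[ i ← allFin k ] c ≡ k * c
∑-allFin-const k c = trans (∑-const (allFin k) c) (cong (_* c) (length-allFin k))

∑-allFin-δ : ∀ {k} (i : Fin k) (f : Fin k → ℕ) → ∑[ j ← allFin k ] (if i == j then f j else 0) ≡ f i
∑-allFin-δ {suc k} i f = trans (∑-allFin-suc k (λ j → if i == j then f j else 0)) (δ-step i)
  where
  δ-step : ∀ i → (if i == zero then f zero else 0)
                  + (∑[ j ← allFin k ] (if i == suc j then f (suc j) else 0)) ≡ f i
  δ-step zero    = trans (cong (f zero +_) (∑-zero (allFin k))) (+-identityʳ (f zero))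
  δ-step (suc i) = ∑-allFin-δ i (f ∘ suc)

∑-allFin-𝟙-== : ∀ {k} (i : Fin k) → ∑[ j ← allFin k ] 𝟙 (j == i) ≡ 1
∑-allFin-𝟙-== {k} i = trans (∑-cong (allFin k) (λ j → trans (cong 𝟙 (==-sym j i)) (𝟙-if (i == j))))
                            (∑-allFin-δ i (λ _ → 1))
  where
  𝟙-if : ∀ b → 𝟙 b ≡ (if b then 1 else 0)
  𝟙-if true  = refl
  𝟙-if false = refl

∑-allFin-𝟙-==-∧ : ∀ {k} (i : Fin k) b → ∑[ j ← allFin k ] 𝟙 ((i == j) ∧ b) ≡ 𝟙 b
∑-allFin-𝟙-==-∧ {k} i b = trans (∑-cong (allFin k) (λ j → 𝟙-∧ (i == j) b)) (∑-allFin-δ i (λ _ → 𝟙 b))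

module _ (G : Graph) where
  private
    V : Set
    V = Fin (n G)
    vs : List V
    vs = allFin (n G)
    d : V → ℕ
    d = deg G
    ∑∑ : (V → V → ℕ) → ℕ
    ∑∑ f = ∑[ i ← vs ] ∑[ j ← vs ] f i j
    isEdge : V × V → Bool
    isEdge (i , j) = (toℕ i <ᵇ toℕ j) ∧ adj G i j

  adj⇒≢ : ∀ {i j} → adj G i j ≡ true → i ≢ j
  adj⇒≢ {i} ij refl with () ← trans (sym ij) (irrefl G i)

  ∑-edges : (h : V × V → ℕ) → ∑ (edges G) h ≡ ∑∑ (λ i j → if isEdge (i , j) then h (i , j) else 0)
  ∑-edges h = trans (∑-filterᵇ isEdge (cartesianProduct vs vs) h) (∑-cartesianProduct vs vs _)

  ∑-edges-cong : {h h′ : V × V → ℕ} →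
    (∀ i j → toℕ i < toℕ j → adj G i j ≡ true → h (i , j) ≡ h′ (i , j)) →
    ∑ (edges G) h ≡ ∑ (edges G) h′
  ∑-edges-cong h≡h′ = ∑-filterᵇ-cong isEdge (cartesianProduct vs vs) λ (i , j) isEdge-ij →
    let (i<ᵇj , ij) = Equivalence.to T-∧ isEdge-ij
    in h≡h′ i j (<ᵇ⇒< (toℕ i) (toℕ j) i<ᵇj) (Equivalence.to T-≡ ij)

  if-adj-split : ∀ i j x → (if adj G i j then x else 0) ≡
    (if isEdge (i , j) then x else 0) + (if isEdge (j , i) then x else 0)
  if-adj-split i j x rewrite Graph.sym G j i
    with toℕ i <ᵇ toℕ j | <ᵇ-reflects-< (toℕ i) (toℕ j)
       | toℕ j <ᵇ toℕ i | <ᵇ-reflects-< (toℕ j) (toℕ i) | adj G i j in ij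
  ... | true  | ofʸ i<j | true  | ofʸ j<i | _     = ⊥-elim (<-asym i<j j<i)
  ... | true  | _       | false | _       | _     = sym (+-identityʳ _)
  ... | false | _       | true  | _       | _     = refl
  ... | false | ofⁿ i≮j | false | ofⁿ j≮i | true  =
    ⊥-elim (adj⇒≢ ij (toℕ-injective (≤-antisym (≮⇒≥ j≮i) (≮⇒≥ i≮j))))
  ... | false | _       | false | _       | false = refl

  ∑-edges-double : (h : V × V → ℕ) → (∀ i j → h (i , j) ≡ h (j , i)) →
    2 * ∑ (edges G) h ≡ ∑∑ (λ i j → if adj G i j then h (i , j) else 0)
  ∑-edges-double h h-sym = sym (begin
    ∑∑ (λ i j → if adj G i j then h (i , j) else 0)
      ≡⟨ trans (∑-cong vs (λ i → ∑-cong vs (λ j → if-adj-split i j (h (i , j)))))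
               (∑-∑-distrib-+ vs vs _ _) ⟩
    S + ∑∑ (λ i j → if isEdge (j , i) then h (i , j) else 0)
      ≡⟨ cong (S +_) (trans (∑-comm vs vs _) (∑-cong vs (λ i → ∑-cong vs (λ j →
           cong (if isEdge (i , j) then_else 0) (h-sym j i))))) ⟩
    S + S
      ≡⟨ cong (S +_) (sym (+-identityʳ S)) ⟩
    2 * S
      ≡⟨ cong (2 *_) (sym (∑-edges h)) ⟩
    2 * ∑ (edges G) h ∎)
    where
    open ≡-Reasoning
    S : ℕ
    S = ∑∑ (λ i j → if isEdge (i , j) then h (i , j) else 0)

  ∑-adj-weighted-deg : (g : V → ℕ) → ∑∑ (λ i j → if adj G i j then g i else 0) ≡ ∑[ i ← vs ] g i * d i
  ∑-adj-weighted-deg g = ∑-cong vs λ i → begin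
    ∑[ j ← vs ] (if adj G i j then g i else 0)
      ≡⟨ ∑-cong vs (λ j → sym (trans (*-comm (g i) _) (𝟙-* (adj G i j) (g i)))) ⟩
    ∑[ j ← vs ] g i * 𝟙 (adj G i j)
      ≡⟨ ∑-distribˡ-* vs (g i) (𝟙 ∘ adj G i) ⟩
    g i * ∑ vs (𝟙 ∘ adj G i)
      ≡⟨ cong (g i *_) (sym (length-filterᵇ (adj G i) vs)) ⟩
    g i * d i ∎
    where open ≡-Reasoning

  ∑-edges-endpoints : (h : V × V → ℕ) (g : V → ℕ) →
    (∀ i j → toℕ i < toℕ j → adj G i j ≡ true → h (i , j) ≡ g i + g j) →
    ∑ (edges G) h ≡ ∑[ i ← vs ] g i * d i
  ∑-edges-endpoints h g h≡g+g = *-cancelˡ-≡ _ _ 2 (begin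
    2 * ∑ (edges G) h
      ≡⟨ cong (2 *_) (∑-edges-cong h≡g+g) ⟩
    2 * (∑[ e ← edges G ] g (proj₁ e) + g (proj₂ e))
      ≡⟨ ∑-edges-double _ (λ i j → +-comm (g i) (g j)) ⟩
    ∑∑ (λ i j → if adj G i j then g i + g j else 0)
      ≡⟨ trans (∑-cong vs (λ i → ∑-cong vs (λ j → if-+ (adj G i j) (g i) (g j))))
               (∑-∑-distrib-+ vs vs _ _) ⟩
    rows + ∑∑ (λ i j → if adj G i j then g j else 0)
      ≡⟨ cong (rows +_) (trans (∑-comm vs vs _) (∑-cong vs (λ i → ∑-cong vs (λ j →
           cong (if_then g i else 0) (Graph.sym G j i))))) ⟩
    rows + rows
      ≡⟨ cong₂ _+_ (∑-adj-weighted-deg g) (trans (∑-adj-weighted-deg g) (sym (+-identityʳ _))) ⟩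
    2 * (∑[ i ← vs ] g i * d i) ∎)
    where
    open ≡-Reasoning
    rows : ℕ
    rows = ∑∑ (λ i j → if adj G i j then g i else 0)

  handshake : ∑ vs d ≡ 2 * ∣E∣ G
  handshake = begin
    ∑ vs d                      ≡⟨ ∑-cong vs (λ i → sym (*-identityˡ (d i))) ⟩
    ∑[ i ← vs ] 1 * d i         ≡⟨ sym (∑-edges-endpoints (λ _ → 2) (λ _ → 1) (λ _ _ _ _ → refl)) ⟩
    ∑[ e ← edges G ] 2          ≡⟨ ∑-const (edges G) 2 ⟩
    ∣E∣ G * 2                   ≡⟨ *-comm (∣E∣ G) 2 ⟩
    2 * ∣E∣ G ∎
    where open ≡-Reasoning

  ∑-edges-cube : ∑[ e ← edges G ] (d (proj₁ e) + d (proj₂ e)) ^ 3 ≡ ξ₄ G + 3 * ReZM G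
  ∑-edges-cube = begin
    ∑[ e ← edges G ] (d (proj₁ e) + d (proj₂ e)) ^ 3
      ≡⟨ ∑-cong (edges G) (λ e → cube (d (proj₁ e)) (d (proj₂ e))) ⟩
    ∑[ e ← edges G ] (d (proj₁ e) ^ 3 + d (proj₂ e) ^ 3) + 3 * rezm e
      ≡⟨ ∑-distrib-+ (edges G) _ _ ⟩
    (∑[ e ← edges G ] d (proj₁ e) ^ 3 + d (proj₂ e) ^ 3) + (∑[ e ← edges G ] 3 * rezm e)
      ≡⟨ cong₂ _+_ cubes (∑-distribˡ-* (edges G) 3 rezm) ⟩
    ξ₄ G + 3 * ReZM G ∎
    where
    open ≡-Reasoning
    rezm : V × V → ℕ
    rezm (u , v) = d u * d v * (d u + d v)
    cube : ∀ a b → (a + b) ^ 3 ≡ (a ^ 3 + b ^ 3) + 3 * (a * b * (a + b))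
    cube = expanded
      where
      expanded : ∀ a b → (a + b) * ((a + b) * ((a + b) * 1)) ≡
        (a * (a * (a * 1)) + b * (b * (b * 1))) + 3 * (a * b * (a + b))
      expanded = solve-∀
    cubes : ∑[ e ← edges G ] d (proj₁ e) ^ 3 + d (proj₂ e) ^ 3 ≡ ξ₄ G
    cubes = trans (∑-edges-endpoints _ (λ i → d i ^ 3) (λ _ _ _ _ → refl))
                  (∑-cong vs (λ i → *-comm (d i ^ 3) (d i)))

  ∑-edges-incident : ∀ u → ∑[ e ← edges G ] 𝟙 (incident u e) ≡ d u
  ∑-edges-incident u = begin
    ∑[ e ← edges G ] 𝟙 (incident u e)
      ≡⟨ ∑-edges-endpoints _ (𝟙 ∘ (u ==_)) (λ i j i<j _ → 𝟙-∨-disjoint (u == i) (u == j)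
           λ (u≡i , u≡j) → <-irrefl (cong toℕ (trans (sym (==⇒≡ u i u≡i)) (==⇒≡ u j u≡j))) i<j) ⟩
    ∑[ i ← vs ] 𝟙 (u == i) * d i
      ≡⟨ ∑-cong vs (λ i → 𝟙-* (u == i) (d i)) ⟩
    ∑[ i ← vs ] (if u == i then d i else 0)
      ≡⟨ ∑-allFin-δ u d ⟩
    d u ∎
    where open ≡-Reasoning

  ∑-incident : ∀ {a b} → a ≢ b → ∑[ u ← vs ] 𝟙 (incident u (a , b)) ≡ 2
  ∑-incident {a} {b} a≢b = begin
    ∑[ u ← vs ] 𝟙 (incident u (a , b))
      ≡⟨ ∑-cong vs (λ u → 𝟙-∨-disjoint (u == a) (u == b)
           λ (u≡a , u≡b) → a≢b (trans (sym (==⇒≡ u a u≡a)) (==⇒≡ u b u≡b))) ⟩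
    ∑[ u ← vs ] 𝟙 (u == a) + 𝟙 (u == b)
      ≡⟨ ∑-distrib-+ vs _ _ ⟩
    (∑[ u ← vs ] 𝟙 (u == a)) + (∑[ u ← vs ] 𝟙 (u == b))
      ≡⟨ cong₂ _+_ (∑-allFin-𝟙-== a) (∑-allFin-𝟙-== b) ⟩
    2 ∎
    where open ≡-Reasoning

  ∑-edges-𝟙-== : ∀ {a b} → toℕ a < toℕ b → adj G a b ≡ true →
    ∑[ e ← edges G ] 𝟙 ((a == proj₁ e) ∧ (b == proj₂ e)) ≡ 1
  ∑-edges-𝟙-== {a} {b} a<b ab = begin
    ∑[ e ← edges G ] 𝟙 ((a == proj₁ e) ∧ (b == proj₂ e))
      ≡⟨ ∑-edges _ ⟩
    ∑∑ (λ i j → if isEdge (i , j) then 𝟙 ((a == i) ∧ (b == j)) else 0)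
      ≡⟨ ∑-cong vs (λ i → trans (∑-cong vs (λ j → if-𝟙-∧ (isEdge (i , j)) (a == i) (b == j)))
                                 (∑-if vs (a == i) _)) ⟩
    ∑[ i ← vs ] (if a == i then ∑[ j ← vs ] (if b == j then 𝟙 (isEdge (i , j)) else 0) else 0)
      ≡⟨ ∑-allFin-δ a _ ⟩
    ∑[ j ← vs ] (if b == j then 𝟙 (isEdge (a , j)) else 0)
      ≡⟨ ∑-allFin-δ b _ ⟩
    𝟙 (isEdge (a , b))
      ≡⟨ cong₂ (λ x y → 𝟙 (x ∧ y)) (Equivalence.to T-≡ (<⇒<ᵇ a<b)) ab ⟩
    1 ∎
    where
    open ≡-Reasoning
    if-𝟙-∧ : ∀ p x y → (if p then 𝟙 (x ∧ y) else 0) ≡ (if x then (if y then 𝟙 p else 0) else 0)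
    if-𝟙-∧ true  true  true  = refl
    if-𝟙-∧ true  true  false = refl
    if-𝟙-∧ false true  true  = refl
    if-𝟙-∧ false true  false = refl
    if-𝟙-∧ true  false y     = refl
    if-𝟙-∧ false false y     = refl

  line-degree : ∀ {a b} → toℕ a < toℕ b → adj G a b ≡ true →
    (∑[ e ← edges G ] 𝟙 (Qadj G (inj₂ (a , b)) (inj₂ e))) + 2 ≡ d a + d b
  line-degree {a} {b} a<b ab = begin
    ∑ (edges G) L + 2
      ≡⟨ cong (λ k → ∑ (edges G) L + 2 * k) (sym (∑-edges-𝟙-== a<b ab)) ⟩
    ∑ (edges G) L + 2 * ∑ (edges G) E
      ≡⟨ cong (∑ (edges G) L +_) (sym (∑-distribˡ-* (edges G) 2 E)) ⟩
    ∑ (edges G) L + (∑[ e ← edges G ] 2 * E e)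
      ≡⟨ sym (∑-distrib-+ (edges G) L _) ⟩
    ∑[ e ← edges G ] L e + 2 * E e
      ≡⟨ ∑-edges-cong count ⟩
    ∑[ e ← edges G ] 𝟙 (incident a e) + 𝟙 (incident b e)
      ≡⟨ ∑-distrib-+ (edges G) _ _ ⟩
    (∑[ e ← edges G ] 𝟙 (incident a e)) + (∑[ e ← edges G ] 𝟙 (incident b e))
      ≡⟨ cong₂ _+_ (∑-edges-incident a) (∑-edges-incident b) ⟩
    d a + d b ∎
    where
    open ≡-Reasoning
    L E : V × V → ℕ
    L e = 𝟙 (Qadj G (inj₂ (a , b)) (inj₂ e))
    E e = 𝟙 ((a == proj₁ e) ∧ (b == proj₂ e))
    ==⇒toℕ≡ : ∀ (x y : V) → T (x == y) → toℕ x ≡ toℕ y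
    ==⇒toℕ≡ x y = ≡ᵇ⇒≡ (toℕ x) (toℕ y)
    -- Only the edge ab itself meets ab at both ends: Qadj excludes it and 2 * E adds it back.
    both-ends : ∀ ac ae bc be →
      ¬ (T ac × T ae) → ¬ (T bc × T be) → ¬ (T ac × T bc) → ¬ (T ae × T be) → ¬ (T ae × T bc) →
      𝟙 (not (ac ∧ be) ∧ ((ac ∨ ae) ∨ (bc ∨ be))) + 2 * 𝟙 (ac ∧ be) ≡ 𝟙 (ac ∨ ae) + 𝟙 (bc ∨ be)
    both-ends true  true  _     _     ¬ac∧ae _ _ _ _ = ⊥-elim (¬ac∧ae _)
    both-ends _     _     true  true  _ ¬bc∧be _ _ _ = ⊥-elim (¬bc∧be _)
    both-ends true  _     true  _     _ _ ¬ac∧bc _ _ = ⊥-elim (¬ac∧bc _)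
    both-ends _     true  _     true  _ _ _ ¬ae∧be _ = ⊥-elim (¬ae∧be _)
    both-ends _     true  true  _     _ _ _ _ ¬ae∧bc = ⊥-elim (¬ae∧bc _)
    both-ends false false false false _ _ _ _ _ = refl
    both-ends true  false false false _ _ _ _ _ = refl
    both-ends false true  false false _ _ _ _ _ = refl
    both-ends false false true  false _ _ _ _ _ = refl
    both-ends false false false true  _ _ _ _ _ = refl
    both-ends true  false false true  _ _ _ _ _ = refl
    count : ∀ c e → toℕ c < toℕ e → adj G c e ≡ true →
      L (c , e) + 2 * E (c , e) ≡ 𝟙 (incident a (c , e)) + 𝟙 (incident b (c , e))
    count c e c<e _ = both-ends (a == c) (a == e) (b == c) (b == e)
      (λ (ac , ae) → <-irrefl (trans (sym (==⇒toℕ≡ a c ac)) (==⇒toℕ≡ a e ae)) c<e)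
      (λ (bc , be) → <-irrefl (trans (sym (==⇒toℕ≡ b c bc)) (==⇒toℕ≡ b e be)) c<e)
      (λ (ac , bc) → <-irrefl (trans (==⇒toℕ≡ a c ac) (sym (==⇒toℕ≡ b c bc))) a<b)
      (λ (ae , be) → <-irrefl (trans (==⇒toℕ≡ a e ae) (sym (==⇒toℕ≡ b e be))) a<b)
      (λ (ae , bc) → <-asym c<e (subst₂ _<_ (==⇒toℕ≡ a e ae) (==⇒toℕ≡ b c bc) a<b))

module _ (G H : Graph) where
  private
    vsG = allFin (n G)
    vsH = allFin (n H)

  ∑-+Q-vertices : (f : QVtx G × Fin (n H) → ℕ) →
    ∑ (verts (G +Q H)) f ≡
      (∑[ u ← vsG ] ∑[ v ← vsH ] f (inj₁ u , v)) + (∑[ e ← edges G ] ∑[ v ← vsH ] f (inj₂ e , v))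
  ∑-+Q-vertices f = begin
    ∑ (cartesianProduct (Qverts G) vsH) f
      ≡⟨ ∑-cartesianProduct (Qverts G) vsH f ⟩
    ∑ (map inj₁ vsG ++ map inj₂ (edges G)) f′
      ≡⟨ ∑-++ (map inj₁ vsG) (map inj₂ (edges G)) f′ ⟩
    ∑ (map inj₁ vsG) f′ + ∑ (map inj₂ (edges G)) f′
      ≡⟨ cong₂ _+_ (∑-map inj₁ vsG f′) (∑-map inj₂ (edges G) f′) ⟩
    ∑ vsG (f′ ∘ inj₁) + ∑ (edges G) (f′ ∘ inj₂) ∎
    where
    open ≡-Reasoning
    f′ : QVtx G → ℕ
    f′ x = ∑[ v ← vsH ] f (x , v)

  deg-+Q-vertex : ∀ u v → degF (G +Q H) (inj₁ u , v) ≡ deg G u + deg H v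
  deg-+Q-vertex u v = begin
    degF (G +Q H) (inj₁ u , v)
      ≡⟨ trans (length-filterᵇ _ (verts (G +Q H))) (∑-+Q-vertices _) ⟩
    (∑[ u′ ← vsG ] ∑[ w ← vsH ] 𝟙 (((u == u′) ∧ adj H v w) ∨ ((v == w) ∧ false)))
      + (∑[ e ← edges G ] ∑[ w ← vsH ] 𝟙 ((v == w) ∧ incident u e))
      ≡⟨ cong₂ _+_ (∑-cong vsG λ u′ → trans (∑-cong vsH (λ w → drop-false (u == u′) (adj H v w) (v == w)))
                                             (∑-if vsH (u == u′) _))
                   (∑-cong (edges G) λ e → ∑-allFin-𝟙-==-∧ v (incident u e)) ⟩
    (∑[ u′ ← vsG ] (if u == u′ then ∑[ w ← vsH ] 𝟙 (adj H v w) else 0))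
      + (∑[ e ← edges G ] 𝟙 (incident u e))
      ≡⟨ cong₂ _+_ (trans (∑-allFin-δ u _) (sym (length-filterᵇ (adj H v) vsH))) (∑-edges-incident G u) ⟩
    deg H v + deg G u
      ≡⟨ +-comm (deg H v) (deg G u) ⟩
    deg G u + deg H v ∎
    where
    open ≡-Reasoning
    drop-false : ∀ p q r → 𝟙 ((p ∧ q) ∨ (r ∧ false)) ≡ (if p then 𝟙 q else 0)
    drop-false p q r = trans (cong (λ s → 𝟙 ((p ∧ q) ∨ s)) (∧-zeroʳ r))
                             (trans (cong 𝟙 (∨-identityʳ (p ∧ q))) (𝟙-∧ p q))

  deg-+Q-edge : ∀ {a b} v → toℕ a < toℕ b → adj G a b ≡ true →
    degF (G +Q H) (inj₂ (a , b) , v) ≡ deg G a + deg G b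
  deg-+Q-edge {a} {b} v a<b ab = begin
    degF (G +Q H) (inj₂ (a , b) , v)
      ≡⟨ trans (length-filterᵇ _ (verts (G +Q H))) (∑-+Q-vertices _) ⟩
    (∑[ u ← vsG ] ∑[ w ← vsH ] 𝟙 ((v == w) ∧ incident u (a , b)))
      + (∑[ e ← edges G ] ∑[ w ← vsH ] 𝟙 ((v == w) ∧ Qadj G (inj₂ (a , b)) (inj₂ e)))
      ≡⟨ cong₂ _+_ (∑-cong vsG λ u → ∑-allFin-𝟙-==-∧ v (incident u (a , b)))
                   (∑-cong (edges G) λ e → ∑-allFin-𝟙-==-∧ v (Qadj G (inj₂ (a , b)) (inj₂ e))) ⟩
    (∑[ u ← vsG ] 𝟙 (incident u (a , b))) + (∑[ e ← edges G ] 𝟙 (Qadj G (inj₂ (a , b)) (inj₂ e)))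
      ≡⟨ cong (_+ (∑[ e ← edges G ] 𝟙 (Qadj G (inj₂ (a , b)) (inj₂ e))))
              (∑-incident G (λ a≡b → <-irrefl (cong toℕ a≡b) a<b)) ⟩
    2 + (∑[ e ← edges G ] 𝟙 (Qadj G (inj₂ (a , b)) (inj₂ e)))
      ≡⟨ trans (+-comm 2 _) (line-degree G a<b ab) ⟩
    deg G a + deg G b ∎
    where open ≡-Reasoning

  F-+Q : FF (G +Q H) ≡
    (∑[ u ← vsG ] ∑[ v ← vsH ] (deg G u + deg H v) ^ 3)
      + n H * (∑[ e ← edges G ] (deg G (proj₁ e) + deg G (proj₂ e)) ^ 3)
  F-+Q = trans (∑-+Q-vertices (λ x → degF (G +Q H) x ^ 3)) (cong₂ _+_
    (∑-cong vsG λ u → ∑-cong vsH λ v → cong (_^ 3) (deg-+Q-vertex u v))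
    (trans (∑-edges-cong G λ a b a<b ab → trans (∑-cong vsH λ v → cong (_^ 3) (deg-+Q-edge v a<b ab))
                                                 (∑-allFin-const (n H) _))
           (∑-distribˡ-* (edges G) (n H) _)))

theorem4 : (G H : Graph) → Connected G → 2 ≤ ∣V∣ G → Connected H →
    FF (G +Q H) ≡ ∣V∣ H * F G + ∣V∣ G * F H + 6 * ∣E∣ H * M₁ G + 6 * ∣E∣ G * M₁ H
    + ∣V∣ H * ξ₄ G + 3 * ∣V∣ H * ReZM G
theorem4 G H _ _ _ = begin
  FF (G +Q H)
    ≡⟨ F-+Q G H ⟩
  (∑[ u ← allFin (n G) ] ∑[ v ← allFin (n H) ] (deg G u + deg H v) ^ 3)
    + n H * (∑[ e ← edges G ] (deg G (proj₁ e) + deg G (proj₂ e)) ^ 3)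
    ≡⟨ cong₂ _+_ (∑-∑-cube (allFin (n G)) (allFin (n H)) (deg G) (deg H))
                 (cong (n H *_) (∑-edges-cube G)) ⟩
  length (allFin (n H)) * F G + length (allFin (n G)) * F H
    + 3 * (∑ (allFin (n G)) (deg G) * M₁ H) + 3 * (M₁ G * ∑ (allFin (n H)) (deg H))
    + n H * (ξ₄ G + 3 * ReZM G)
    ≡⟨ cong₂ (λ ℓH ℓG → ℓH * F G + ℓG * F H + 3 * (∑ (allFin (n G)) (deg G) * M₁ H)
                       + 3 * (M₁ G * ∑ (allFin (n H)) (deg H)) + n H * (ξ₄ G + 3 * ReZM G))
             (length-allFin (n H)) (length-allFin (n G)) ⟩
  n H * F G + n G * F H + 3 * (∑ (allFin (n G)) (deg G) * M₁ H) + 3 * (M₁ G * ∑ (allFin (n H)) (deg H))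
    + n H * (ξ₄ G + 3 * ReZM G)
    ≡⟨ cong₂ (λ ∑dG ∑dH → n H * F G + n G * F H + 3 * (∑dG * M₁ H) + 3 * (M₁ G * ∑dH)
                          + n H * (ξ₄ G + 3 * ReZM G))
             (handshake G) (handshake H) ⟩
  n H * F G + n G * F H + 3 * (2 * ∣E∣ G * M₁ H) + 3 * (M₁ G * (2 * ∣E∣ H)) + n H * (ξ₄ G + 3 * ReZM G)
    ≡⟨ collect (n G) (n H) (F G) (F H) (∣E∣ G) (∣E∣ H) (M₁ G) (M₁ H) (ξ₄ G) (ReZM G) ⟩
  n H * F G + n G * F H + 6 * ∣E∣ H * M₁ G + 6 * ∣E∣ G * M₁ H + n H * ξ₄ G + 3 * n H * ReZM G ∎
  where
  open ≡-Reasoning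
  collect : ∀ nG nH FG FH EG EH MG MH XG RG →
    nH * FG + nG * FH + 3 * (2 * EG * MH) + 3 * (MG * (2 * EH)) + nH * (XG + 3 * RG) ≡
    nH * FG + nG * FH + 6 * EH * MG + 6 * EG * MH + nH * XG + 3 * nH * RG
  collect = solve-∀
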